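{- Let $f:L \rightarrow M$ be a morphism in $\mathbf{OA}$; then the following are equivalent: (1) $f$ preserves finite meets; (2) $f^\dagger\dashv f$ (i.e. $f^\dagger$ is left adjoint to $f$).
   Context: Work in intuitionistic logic without choice. A positivity predicate on a complete lattice $L$ is a unary predicate $\mathrm{Pos}$ such that: (i) $\mathrm{Pos}(x)$ and $x\le y$ imply $\mathrm{Pos}(y)$; (ii) $\mathrm{Pos}(\bigvee X)$ implies $\mathrm{Pos}(x)$ for some $x\in X$; (iii) if $\mathrm{Pos}(x)\Rightarrow x\le y$, then $x\le y$. An o-algebra is a frame $L$ with a positivity predicate such that for all $x,y$: if $\mathrm{Pos}(z\wedge x)\Rightarrow\mathrm{Pos}(z\wedge y)$ for every $z\in L$, then $x\le y$. Write $x\bowtie y$ (overlap) for $\mathrm{Pos}(x\wedge y)$. Functions $f:L\to M$, $g:M\to L$ are symmetric if $f(x)\bowtie y\iff x\bowtie g(y)$; $f$ is symmetrizable if it has a (unique) symmetric $f^\dagger$. $\mathbf{OA}$ is the category of o-algebras and symmetrizable functions. -}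

module Defs where

open import Level using (Level; _⊔_) renaming (suc to lsuc)
open import Data.Product using (Σ; ∃; _×_; _,_)
open import Function.Bundles using (_⇔_)

record Frame (c ℓ ι : Level) : Set (lsuc (c ⊔ ℓ ⊔ ι)) where
  infix 4 _≤_ _≈_
  infixr 7 _∧_
  field
    Carrier : Set c
    _≤_     : Carrier → Carrier → Set ℓ
    ≤-refl  : ∀ {x} → x ≤ x
    ≤-trans : ∀ {x y z} → x ≤ y → y ≤ z → x ≤ z
    _∧_     : Carrier → Carrier → Carrier
    ∧-lb₁   : ∀ {x y} → x ∧ y ≤ x
    ∧-lb₂   : ∀ {x y} → x ∧ y ≤ y
    ∧-glb   : ∀ {x y z} → z ≤ x → z ≤ y → z ≤ x ∧ y
    ⊤       : Carrier
    ⊤-max   : ∀ {x} → x ≤ ⊤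
    ⋁       : {I : Set ι} → (I → Carrier) → Carrier
    ⋁-ub    : ∀ {I : Set ι} (F : I → Carrier) (i : I) → F i ≤ ⋁ F
    ⋁-lub   : ∀ {I : Set ι} (F : I → Carrier) {y} → (∀ i → F i ≤ y) → ⋁ F ≤ y
    ∧-distrib-⋁ : ∀ {I : Set ι} (x : Carrier) (F : I → Carrier) →
                  x ∧ ⋁ F ≤ ⋁ (λ i → x ∧ F i)

  _≈_ : Carrier → Carrier → Set ℓ
  x ≈ y = (x ≤ y) × (y ≤ x)

record OAlgebra (c ℓ ι p : Level) : Set (lsuc (c ⊔ ℓ ⊔ ι ⊔ p)) where
  field
    frame : Frame c ℓ ι
  open Frame frame public
  field
    Pos       : Carrier → Set p
    Pos-mono  : ∀ {x y} → Pos x → x ≤ y → Pos y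
    Pos-⋁     : ∀ {I : Set ι} (F : I → Carrier) → Pos (⋁ F) → ∃ λ i → Pos (F i)
    Pos-split : ∀ {x y} → (Pos x → x ≤ y) → x ≤ y
    sep       : ∀ {x y} → (∀ z → Pos (z ∧ x) → Pos (z ∧ y)) → x ≤ y

  _⋈_ : Carrier → Carrier → Set p
  x ⋈ y = Pos (x ∧ y)

module _ {c₁ ℓ₁ ι₁ p₁ c₂ ℓ₂ ι₂ p₂ : Level}
         (L : OAlgebra c₁ ℓ₁ ι₁ p₁) (M : OAlgebra c₂ ℓ₂ ι₂ p₂) where
  private
    module L = OAlgebra L
    module M = OAlgebra M

  Symmetric : (L.Carrier → M.Carrier) → (M.Carrier → L.Carrier) → Set (c₁ ⊔ c₂ ⊔ p₁ ⊔ p₂)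
  Symmetric f g = ∀ (x : L.Carrier) (y : M.Carrier) → (f x M.⋈ y) ⇔ (x L.⋈ g y)

  -- f is symmetrizable (a morphism of OA): it has a symmetric g (= f†)
  Symmetrizable : (L.Carrier → M.Carrier) → Set (c₁ ⊔ c₂ ⊔ p₁ ⊔ p₂)
  Symmetrizable f = Σ (M.Carrier → L.Carrier) (Symmetric f)

  PreservesFiniteMeets : (L.Carrier → M.Carrier) → Set (c₁ ⊔ ℓ₂)
  PreservesFiniteMeets f =
    (f L.⊤ M.≈ M.⊤) × (∀ x y → f (x L.∧ y) M.≈ (f x M.∧ f y))

module _ {c₁ ℓ₁ ι₁ p₁ c₂ ℓ₂ ι₂ p₂ : Level}
         (L : OAlgebra c₁ ℓ₁ ι₁ p₁) (M : OAlgebra c₂ ℓ₂ ι₂ p₂) where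
  private
    module L = OAlgebra L
    module M = OAlgebra M

  LeftAdjoint : (M.Carrier → L.Carrier) → (L.Carrier → M.Carrier) → Set (c₁ ⊔ c₂ ⊔ ℓ₁ ⊔ ℓ₂)
  LeftAdjoint g f = ∀ (x : L.Carrier) (y : M.Carrier) → (g y L.≤ x) ⇔ (y M.≤ f x)

module Submission where

-- Let g = f† be the symmetric partner of f, so f x ⋈ y ⇔ x ⋈ g y.
-- (2 ⇒ 1) holds for any adjunction g ⊣ f between frames: a right adjoint
--   preserves all existing meets, in particular ⊤ and binary meets.
-- (1 ⇒ 2) By the usual unit/counit characterisation it suffices that f and g
--   are monotone, y ≤ f (g y) and g (f x) ≤ x.  Monotonicity holds for every
--   symmetric pair.  Each of the two inequalities is proved with the
--   o-algebra separation axiom, transporting overlaps along the symmetry: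
--   the unit uses ⊤ ≤ f ⊤ (via Pos (g y) ⇐ f ⊤ ⋈ y) and the counit uses
--   f x ∧ f y ≤ f (x ∧ y) (via Pos (f x) ⇒ x ⋈ g ⊤).

open import Defs
open import Level using (Level)
open import Data.Product using (_,_; proj₁; proj₂)
open import Function.Bundles using (_⇔_; mk⇔; Equivalence)

module Overlap {c ℓ ι p : Level} (A : OAlgebra c ℓ ι p) where
  open OAlgebra A

  ⋈-sym : ∀ {x y} → x ⋈ y → y ⋈ x
  ⋈-sym o = Pos-mono o (∧-glb ∧-lb₂ ∧-lb₁)

  Pos⇒⋈ : ∀ {u x y} → Pos u → u ≤ x → u ≤ y → x ⋈ y
  Pos⇒⋈ pu u≤x u≤y = Pos-mono pu (∧-glb u≤x u≤y)

  ⋈-mono : ∀ {x x′ y y′} → x ≤ x′ → y ≤ y′ → x ⋈ y → x′ ⋈ y′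
  ⋈-mono x≤x′ y≤y′ o = Pos⇒⋈ o (≤-trans ∧-lb₁ x≤x′) (≤-trans ∧-lb₂ y≤y′)

  ⋈⇒Pos : ∀ {x y} → x ⋈ y → Pos x
  ⋈⇒Pos o = Pos-mono o ∧-lb₁

  Pos⇒⋈⊤ : ∀ {x} → Pos x → x ⋈ ⊤
  Pos⇒⋈⊤ px = Pos⇒⋈ px ≤-refl ⊤-max

module SymmetricPair {c₁ ℓ₁ ι₁ p₁ c₂ ℓ₂ ι₂ p₂ : Level}
    (L : OAlgebra c₁ ℓ₁ ι₁ p₁) (M : OAlgebra c₂ ℓ₂ ι₂ p₂)
    (f : OAlgebra.Carrier L → OAlgebra.Carrier M)
    (g : OAlgebra.Carrier M → OAlgebra.Carrier L)
    (sym : Symmetric L M f g) where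
  private
    module L = OAlgebra L
    module M = OAlgebra M
    module OL = Overlap L
    module OM = Overlap M

  move-right : ∀ {x y} → f x M.⋈ y → x L.⋈ g y
  move-right {x} {y} = Equivalence.to (sym x y)

  move-left : ∀ {x y} → x L.⋈ g y → f x M.⋈ y
  move-left {x} {y} = Equivalence.from (sym x y)

  f-mono : ∀ {x x′} → x L.≤ x′ → f x M.≤ f x′
  f-mono x≤x′ = M.sep λ z z⋈fx →
    OM.⋈-sym (move-left (OL.⋈-mono x≤x′ L.≤-refl (move-right (OM.⋈-sym z⋈fx))))

  g-mono : ∀ {y y′} → y M.≤ y′ → g y L.≤ g y′
  g-mono y≤y′ = L.sep λ z z⋈gy →
    move-right (OM.⋈-mono M.≤-refl y≤y′ (move-left z⋈gy))

  Pos-g : ∀ {y} → f L.⊤ M.⋈ y → L.Pos (g y)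
  Pos-g o = OL.⋈⇒Pos (OL.⋈-sym (move-right o))

  Pos-f : ∀ {x} → M.Pos (f x) → x L.⋈ g M.⊤
  Pos-f pfx = move-right (OM.Pos⇒⋈⊤ pfx)

  unit : M.⊤ M.≤ f L.⊤ → ∀ {y} → y M.≤ f (g y)
  unit ⊤≤f⊤ {y} = M.sep λ z z⋈y →
    let f⊤⋈z∧y : f L.⊤ M.⋈ (z M.∧ y)
        f⊤⋈z∧y = OM.⋈-mono ⊤≤f⊤ M.≤-refl (OM.⋈-sym (OM.Pos⇒⋈⊤ z⋈y))
        gy⋈gz : g y L.⋈ g z
        gy⋈gz = OL.Pos⇒⋈ (Pos-g f⊤⋈z∧y) (g-mono M.∧-lb₂) (g-mono M.∧-lb₁)
    in OM.⋈-sym (move-left gy⋈gz)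

  counit : (∀ {x x′} → f x M.∧ f x′ M.≤ f (x L.∧ x′)) → ∀ {x} → g (f x) L.≤ x
  counit ∧-lax {x} = L.sep λ z z⋈gfx →
    let Pos-f[z∧x] : M.Pos (f (z L.∧ x))
        Pos-f[z∧x] = M.Pos-mono (move-left z⋈gfx) ∧-lax
    in OL.⋈⇒Pos (Pos-f Pos-f[z∧x])

module Adjunction {c₁ ℓ₁ ι₁ p₁ c₂ ℓ₂ ι₂ p₂ : Level}
    (L : OAlgebra c₁ ℓ₁ ι₁ p₁) (M : OAlgebra c₂ ℓ₂ ι₂ p₂)
    {f : OAlgebra.Carrier L → OAlgebra.Carrier M}
    {g : OAlgebra.Carrier M → OAlgebra.Carrier L} where
  private
    module L = OAlgebra L
    module M = OAlgebra M

  unit-counit⇒adjoint : (∀ {x x′} → x L.≤ x′ → f x M.≤ f x′) →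
                        (∀ {y y′} → y M.≤ y′ → g y L.≤ g y′) →
                        (∀ {y} → y M.≤ f (g y)) → (∀ {x} → g (f x) L.≤ x) →
                        LeftAdjoint L M g f
  unit-counit⇒adjoint f-mono g-mono η ε x y = mk⇔
    (λ gy≤x → M.≤-trans η (f-mono gy≤x))
    (λ y≤fx → L.≤-trans (g-mono y≤fx) ε)

  rightAdjoint-preserves-meets : LeftAdjoint L M g f → PreservesFiniteMeets L M f
  rightAdjoint-preserves-meets adj =
    (M.⊤-max , transpose L.⊤-max) , λ x y →
      M.∧-glb (f-mono L.∧-lb₁) (f-mono L.∧-lb₂) ,
      transpose (L.∧-glb (transpose⁻¹ M.∧-lb₁) (transpose⁻¹ M.∧-lb₂))
    where
    transpose : ∀ {x y} → g y L.≤ x → y M.≤ f x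
    transpose {x} {y} = Equivalence.to (adj x y)

    transpose⁻¹ : ∀ {x y} → y M.≤ f x → g y L.≤ x
    transpose⁻¹ {x} {y} = Equivalence.from (adj x y)

    -- the counit g (f x) ≤ x makes f monotone
    f-mono : ∀ {x x′} → x L.≤ x′ → f x M.≤ f x′
    f-mono x≤x′ = transpose (L.≤-trans (transpose⁻¹ M.≤-refl) x≤x′)

lemma5p1 : ∀ {c₁ ℓ₁ ι₁ p₁ c₂ ℓ₂ ι₂ p₂ : Level}
    (L : OAlgebra c₁ ℓ₁ ι₁ p₁) (M : OAlgebra c₂ ℓ₂ ι₂ p₂)
    (f : OAlgebra.Carrier L → OAlgebra.Carrier M) (s : Symmetrizable L M f) →
    PreservesFiniteMeets L M f ⇔ LeftAdjoint L M (proj₁ s) f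
lemma5p1 L M f (g , sym) = mk⇔ meets⇒adjoint (rightAdjoint-preserves-meets L M)
  where
  open SymmetricPair L M f g sym
  open Adjunction using (unit-counit⇒adjoint; rightAdjoint-preserves-meets)

  meets⇒adjoint : PreservesFiniteMeets L M f → LeftAdjoint L M g f
  meets⇒adjoint ((_ , ⊤≤f⊤) , f-∧) =
    unit-counit⇒adjoint L M f-mono g-mono (unit ⊤≤f⊤) (counit (proj₂ (f-∧ _ _)))
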